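{- For every integer $m \geq 0$, $$E_m = \sum_{n=0}^m C_n (-1)^n 2^{m-2n}\, n!\, S_2(m,n).$$
   Context: The Euler numbers $E_n$ are defined by $\frac{2}{e^t+1} = \sum_{n\ge 0} E_n \frac{t^n}{n!}$. $C_n = \frac{1}{n+1}\binom{2n}{n}$ is the $n$-th Catalan number. The Stirling numbers of the second kind $S_2(n,l)$ are defined by $x^n = \sum_{l=0}^n S_2(n,l)(x)_l$, where $(x)_l = x(x-1)\cdots(x-l+1)$. -}

module Defs where

open import Data.Nat as ℕ using (ℕ; zero; suc; _!; _≤ᵇ_)
open import Data.Nat.Properties using (_!≢0; m^n≢0)
open import Data.Nat.Combinatorics using (_C_)
open import Data.Integer using (+_)
open import Data.Bool using (if_then_else_)
open import Data.Rational using (ℚ; _/_; _+_; _*_; -_; 0ℚ; 1ℚ)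

ι : ℕ → ℚ
ι n = + n / 1

sumTo : ℕ → (ℕ → ℚ) → ℚ
sumTo zero    f = f 0
sumTo (suc m) f = sumTo m f + f (suc m)

invFact : ℕ → ℚ
invFact n = (+ 1 / (n !)) {{n !≢0}}

sign : ℕ → ℚ
sign zero    = 1ℚ
sign (suc n) = - sign n

-- 2^(m - 2n) as a rational number (the exponent may be negative)
pow2 : ℕ → ℕ → ℚ
pow2 m n = if (2 ℕ.* n) ≤ᵇ m
           then ι (2 ℕ.^ (m ℕ.∸ 2 ℕ.* n))
           else (+ 1 / (2 ℕ.^ (2 ℕ.* n ℕ.∸ m))) {{m^n≢0 2 (2 ℕ.* n ℕ.∸ m)}}

catalan : ℕ → ℚ
catalan n = (+ ((2 ℕ.* n) C n) / suc n)

S₂ : ℕ → ℕ → ℕ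
S₂ zero    zero    = 1
S₂ zero    (suc l) = 0
S₂ (suc n) zero    = 0
S₂ (suc n) (suc l) = suc l ℕ.* S₂ n (suc l) ℕ.+ S₂ n l

-- E is the EGF coefficient sequence of 2/(e^t+1), i.e. (e^t + 1) · Σ E_n t^n/n! = 2
-- as formal power series; coefficient of t^m:
--   Σ_{k=0}^m (1/(m-k)!) (E_k/k!) + E_m/m! = 2·[m = 0]
IsEulerSeq : (ℕ → ℚ) → Set
IsEulerSeq E = ∀ m →
  sumTo m (λ k → invFact (m ℕ.∸ k) * (E k * invFact k)) + E m * invFact m
    ≡ (if m ℕ.≡ᵇ 0 then ι 2 else 0ℚ)
  where open import Relation.Binary.PropositionalEquality using (_≡_)

rhs : ℕ → ℚ
rhs m = sumTo m (λ n → catalan n * sign n * pow2 m n * ι (n !) * ι (S₂ m n))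

-- Work with exponential generating functions, multiplied by the binomial convolution ⊛.
-- Put X = e^{2t} − 1. The sequence m ↦ 2^m n! S₂(m,n) has EGF X^n, and 2^{m−2n} = 2^m (1/4)^n,
-- so the right-hand side R has EGF Σ a_n X^n with a_n = C_n (−1/4)^n, i.e. R = c(−X/4) for the
-- Catalan series c. The series F = X R = Σ a_n X^{n+1} has F(0) = 0 and F' = F + 2: differentiating
-- X^{n+1} gives 2(n+1)(X^{n+1} + X^n), and the Catalan recurrence (n+2) C_{n+1} = 2(2n+1) C_n makes
-- the remaining terms telescope. So X R = 2(e^t − 1). On the other side (e^t + 1) E = 2 and
-- X = (e^t − 1)(e^t + 1) give X E = 2(e^t − 1) too, and multiplication by X, whose expansion
-- starts with 2t, is injective.

{-# OPTIONS --safe #-}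
module Submission where

open import Defs
open import Data.Nat using (ℕ)
open import Data.Rational using (ℚ)
open import Relation.Binary.PropositionalEquality using (_≡_)

open import Data.Bool using (true; false; T; if_then_else_)
open import Data.Nat as ℕ using (zero; suc; NonZero; _≤_; _<_; z≤n; s≤s; _∸_; _^_; _!; _≤ᵇ_)
import Data.Nat.Properties as ℕₚ
import Data.Nat.Coprimality as Coprime
open import Data.Nat.Combinatorics using (_C_; nCk+nC[k+1]≡[n+1]C[k+1]; nC1≡n; nCk≡nC[n∸k])
open import Data.Nat.Induction using (<-rec)
import Data.Integer as ℤ
import Data.Integer.Properties as ℤₚ
open import Data.Rational using (mkℚ; _/_; _+_; _*_; -_; 1/_; 0ℚ; 1ℚ; +-*-rawSemiring; ≢-nonZero)
open import Data.Rational.Properties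
open import Data.Sum using (inj₁; inj₂)
open import Data.Unit using (tt)
open import Function using (const)
open import Relation.Binary.PropositionalEquality
  using (_≢_; _≗_; refl; sym; trans; cong; cong₂; subst; module ≡-Reasoning)
open import Algebra.Definitions.RawSemiring +-*-rawSemiring using () renaming (_^_ to _^ℚ_)
open import Algebra.Bundles using (CommutativeMonoid)
open import Algebra.Properties.CommutativeSemigroup
  (CommutativeMonoid.commutativeSemigroup +-0-commutativeMonoid) using () renaming (interchange to +-interchange)
import Data.Nat.Solver as ℕ-Solver
import Data.Rational.Solver as ℚ-Solver

open ≡-Reasoning

ι≡mkℚ : ∀ n → ι n ≡ mkℚ (ℤ.+ n) 0 (Coprime.sym (Coprime.1-coprimeTo n))
ι≡mkℚ n = normalize-coprime (Coprime.sym (Coprime.1-coprimeTo n))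

ι-homo-+ : ∀ m n → ι (m ℕ.+ n) ≡ ι m + ι n
ι-homo-+ m n rewrite ι≡mkℚ m | ι≡mkℚ n = /-cong
  (trans (ℤₚ.pos-+ m n) (sym (cong₂ ℤ._+_ (ℤₚ.*-identityʳ (ℤ.+ m)) (ℤₚ.*-identityʳ (ℤ.+ n))))) refl

ι-homo-* : ∀ m n → ι (m ℕ.* n) ≡ ι m * ι n
ι-homo-* m n rewrite ι≡mkℚ m | ι≡mkℚ n = /-cong (ℤₚ.pos-* m n) refl

1/n*ιn≡1 : ∀ n .{{_ : NonZero n}} → (ℤ.+ 1 / n) * ι n ≡ 1ℚ
1/n*ιn≡1 (suc n) rewrite ι≡mkℚ (suc n) | normalize-coprime {1} {n} (Coprime.1-coprimeTo (suc n)) =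
  *-inverseˡ (mkℚ (ℤ.+ suc n) 0 (Coprime.sym (Coprime.1-coprimeTo (suc n))))

m/n≡ιm*1/n : ∀ m n .{{_ : NonZero n}} → ℤ.+ m / n ≡ ι m * (ℤ.+ 1 / n)
m/n≡ιm*1/n m (suc n) rewrite ι≡mkℚ m | normalize-coprime {1} {n} (Coprime.1-coprimeTo (suc n)) =
  /-cong (sym (ℤₚ.*-identityʳ (ℤ.+ m))) (sym (ℕₚ.*-identityˡ (suc n)))

*-cancelʳ-≡ : ∀ x y {k} d → k * d ≡ 1ℚ → x * k ≡ y * k → x ≡ y
*-cancelʳ-≡ x y {k} d kd≡1 xk≡yk = begin
  x            ≡⟨ undo x ⟨
  x * k * d    ≡⟨ cong (_* d) xk≡yk ⟩
  y * k * d    ≡⟨ undo y ⟩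
  y            ∎
  where
  undo : ∀ z → z * k * d ≡ z
  undo z = trans (*-assoc z k d) (trans (cong (z *_) kd≡1) (*-identityʳ z))

inverse-unique : ∀ x y k → x * k ≡ 1ℚ → y * k ≡ 1ℚ → x ≡ y
inverse-unique x y k xk≡1 yk≡1 =
  *-cancelʳ-≡ x y x (trans (*-comm k x) xk≡1) (trans xk≡1 (sym yk≡1))

*-cancelʳ-ι : ∀ x y n .{{_ : NonZero n}} → x * ι n ≡ y * ι n → x ≡ y
*-cancelʳ-ι x y n = *-cancelʳ-≡ x y (ℤ.+ 1 / n) (trans (*-comm (ι n) _) (1/n*ιn≡1 n))

invFact*n!≡1 : ∀ n → invFact n * ι (n !) ≡ 1ℚ
invFact*n!≡1 n = 1/n*ιn≡1 (n !) {{ℕₚ._!≢0 n}}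

invFact-suc : ∀ n → invFact (suc n) * ι (suc n) ≡ invFact n
invFact-suc n = inverse-unique _ _ (ι (n !)) times-n!≡1 (invFact*n!≡1 n)
  where
  times-n!≡1 : invFact (suc n) * ι (suc n) * ι (n !) ≡ 1ℚ
  times-n!≡1 = begin
    invFact (suc n) * ι (suc n) * ι (n !)   ≡⟨ *-assoc (invFact (suc n)) _ _ ⟩
    invFact (suc n) * (ι (suc n) * ι (n !)) ≡⟨ cong (invFact (suc n) *_) (ι-homo-* (suc n) (n !)) ⟨
    invFact (suc n) * ι (suc n !)           ≡⟨ invFact*n!≡1 (suc n) ⟩
    1ℚ                                      ∎

sumTo-cong : ∀ N {f g : ℕ → ℚ} → (∀ k → k ≤ N → f k ≡ g k) → sumTo N f ≡ sumTo N g
sumTo-cong zero    f≡g = f≡g 0 z≤n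
sumTo-cong (suc N) f≡g = cong₂ _+_
  (sumTo-cong N (λ k k≤N → f≡g k (ℕₚ.m≤n⇒m≤1+n k≤N))) (f≡g (suc N) ℕₚ.≤-refl)

sumTo-+ : ∀ N (f g : ℕ → ℚ) → sumTo N (λ k → f k + g k) ≡ sumTo N f + sumTo N g
sumTo-+ zero    f g = refl
sumTo-+ (suc N) f g =
  trans (cong (_+ (f (suc N) + g (suc N))) (sumTo-+ N f g))
        (+-interchange (sumTo N f) (sumTo N g) (f (suc N)) (g (suc N)))

sumTo-* : ∀ N c (f : ℕ → ℚ) → sumTo N (λ k → c * f k) ≡ c * sumTo N f
sumTo-* zero    c f = refl
sumTo-* (suc N) c f =
  trans (cong (_+ c * f (suc N)) (sumTo-* N c f)) (sym (*-distribˡ-+ c (sumTo N f) (f (suc N))))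

sumTo-shift : ∀ N (f : ℕ → ℚ) → sumTo (suc N) f ≡ f 0 + sumTo N (λ k → f (suc k))
sumTo-shift zero    f = refl
sumTo-shift (suc N) f = trans (cong (_+ f (suc (suc N))) (sumTo-shift N f)) (+-assoc (f 0) _ _)

sumTo-zero : ∀ N {f : ℕ → ℚ} → (∀ k → k ≤ N → f k ≡ 0ℚ) → sumTo N f ≡ 0ℚ
sumTo-zero zero    f≡0 = f≡0 0 z≤n
sumTo-zero (suc N) f≡0 = cong₂ _+_
  (sumTo-zero N (λ k k≤N → f≡0 k (ℕₚ.m≤n⇒m≤1+n k≤N))) (f≡0 (suc N) ℕₚ.≤-refl)

sumTo-last : ∀ N {f : ℕ → ℚ} → (∀ k → k < N → f k ≡ 0ℚ) → sumTo N f ≡ f N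
sumTo-last zero    _   = refl
sumTo-last (suc N) {f} f≡0 =
  trans (cong (_+ f (suc N)) (sumTo-zero N (λ k k≤N → f≡0 k (s≤s k≤N)))) (+-identityˡ (f (suc N)))

sumTo-extend : ∀ {M} N {f : ℕ → ℚ} → (∀ k → M < k → f k ≡ 0ℚ) → M ≤ N →
               sumTo M f ≡ sumTo N f
sumTo-extend N f≡0 M≤N with ℕₚ.m≤n⇒m<n∨m≡n M≤N
sumTo-extend N           f≡0 _ | inj₂ refl = refl
sumTo-extend {M} (suc N) {f} f≡0 _ | inj₁ M<1+N = begin
  sumTo M f              ≡⟨ sumTo-extend N f≡0 (ℕₚ.≤-pred M<1+N) ⟩
  sumTo N f              ≡⟨ +-identityʳ (sumTo N f) ⟨
  sumTo N f + 0ℚ         ≡⟨ cong (sumTo N f +_) (f≡0 (suc N) M<1+N) ⟨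
  sumTo N f + f (suc N)  ∎

Seq : Set
Seq = ℕ → ℚ

∂ : Seq → Seq
∂ f k = f (suc k)

infixl 6 _⊕_
infixr 8 _·_
infixl 7 _⊛_

_⊕_ : Seq → Seq → Seq
(f ⊕ g) k = f k + g k

_·_ : ℚ → Seq → Seq
(c · f) k = c * f k

-- Product of exponential generating functions, (f ⊛ g) m = Σₖ (m choose k) f k g (m ∸ k),
-- defined through the Leibniz rule ∂ (f ⊛ g) = ∂ f ⊛ g + f ⊛ ∂ g.
_⊛_ : Seq → Seq → Seq
(f ⊛ g) zero    = f 0 * g 0
(f ⊛ g) (suc m) = (∂ f ⊛ g) m + (f ⊛ ∂ g) m

δ : Seq
δ zero    = 1ℚ
δ (suc _) = 0ℚ

⊛-cong-≤ : ∀ m {f f′ g g′ : Seq} → (∀ k → k ≤ m → f k ≡ f′ k) → (∀ k → k ≤ m → g k ≡ g′ k) →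
           (f ⊛ g) m ≡ (f′ ⊛ g′) m
⊛-cong-≤ zero    f≡ g≡ = cong₂ _*_ (f≡ 0 z≤n) (g≡ 0 z≤n)
⊛-cong-≤ (suc m) f≡ g≡ = cong₂ _+_
  (⊛-cong-≤ m (λ k k≤m → f≡ (suc k) (s≤s k≤m)) (λ k k≤m → g≡ k (m≤n⇒m≤1+n k≤m)))
  (⊛-cong-≤ m (λ k k≤m → f≡ k (m≤n⇒m≤1+n k≤m)) (λ k k≤m → g≡ (suc k) (s≤s k≤m)))
  where open ℕₚ using (m≤n⇒m≤1+n)

⊛-congˡ : ∀ {f f′} g → f ≗ f′ → f ⊛ g ≗ f′ ⊛ g
⊛-congˡ g f≗f′ m = ⊛-cong-≤ m (λ k _ → f≗f′ k) (λ _ _ → refl)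

⊛-congʳ : ∀ f {g g′} → g ≗ g′ → f ⊛ g ≗ f ⊛ g′
⊛-congʳ f g≗g′ m = ⊛-cong-≤ m (λ _ _ → refl) (λ k _ → g≗g′ k)

⊛-comm : ∀ f g → f ⊛ g ≗ g ⊛ f
⊛-comm f g zero    = *-comm (f 0) (g 0)
⊛-comm f g (suc m) =
  trans (cong₂ _+_ (⊛-comm (∂ f) g m) (⊛-comm f (∂ g) m)) (+-comm ((g ⊛ ∂ f) m) _)

⊛-distribˡ-⊕ : ∀ f g h → f ⊛ (g ⊕ h) ≗ f ⊛ g ⊕ f ⊛ h
⊛-distribˡ-⊕ f g h zero    = *-distribˡ-+ (f 0) (g 0) (h 0)
⊛-distribˡ-⊕ f g h (suc m) =
  trans (cong₂ _+_ (⊛-distribˡ-⊕ (∂ f) g h m) (⊛-distribˡ-⊕ f (∂ g) (∂ h) m))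
        (+-interchange ((∂ f ⊛ g) m) ((∂ f ⊛ h) m) ((f ⊛ ∂ g) m) ((f ⊛ ∂ h) m))

⊛-distribʳ-⊕ : ∀ f g h → (g ⊕ h) ⊛ f ≗ g ⊛ f ⊕ h ⊛ f
⊛-distribʳ-⊕ f g h m = begin
  ((g ⊕ h) ⊛ f) m           ≡⟨ ⊛-comm (g ⊕ h) f m ⟩
  (f ⊛ (g ⊕ h)) m           ≡⟨ ⊛-distribˡ-⊕ f g h m ⟩
  (f ⊛ g) m + (f ⊛ h) m     ≡⟨ cong₂ _+_ (⊛-comm f g m) (⊛-comm f h m) ⟩
  (g ⊛ f) m + (h ⊛ f) m     ∎

⊛-scalarʳ : ∀ f c g → f ⊛ c · g ≗ c · (f ⊛ g)
⊛-scalarʳ f c g zero    = solve 3 (λ x c y → x :* (c :* y) := c :* (x :* y)) refl (f 0) c (g 0)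
  where open ℚ-Solver.+-*-Solver
⊛-scalarʳ f c g (suc m) =
  trans (cong₂ _+_ (⊛-scalarʳ (∂ f) c g m) (⊛-scalarʳ f c (∂ g) m)) (sym (*-distribˡ-+ c _ _))

⊛-scalarˡ : ∀ c f g → c · f ⊛ g ≗ c · (f ⊛ g)
⊛-scalarˡ c f g m =
  trans (⊛-comm (c · f) g m) (trans (⊛-scalarʳ g c f m) (cong (c *_) (⊛-comm g f m)))

⊛-zeroʳ : ∀ f → f ⊛ const 0ℚ ≗ const 0ℚ
⊛-zeroʳ f zero    = *-zeroʳ (f 0)
⊛-zeroʳ f (suc m) = cong₂ _+_ (⊛-zeroʳ (∂ f) m) (⊛-zeroʳ f m)

⊛-identityˡ : ∀ f → δ ⊛ f ≗ f
⊛-identityˡ f zero    = *-identityˡ (f 0)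
⊛-identityˡ f (suc m) = begin
  (∂ δ ⊛ f) m + (δ ⊛ ∂ f) m
    ≡⟨ cong₂ _+_ (trans (⊛-comm (∂ δ) f m) (⊛-zeroʳ f m)) (⊛-identityˡ (∂ f) m) ⟩
  0ℚ + f (suc m)
    ≡⟨ +-identityˡ (f (suc m)) ⟩
  f (suc m)
    ∎

⊛-identityʳ : ∀ f → f ⊛ δ ≗ f
⊛-identityʳ f m = trans (⊛-comm f δ m) (⊛-identityˡ f m)

⊛-assoc : ∀ f g h → (f ⊛ g) ⊛ h ≗ f ⊛ (g ⊛ h)
⊛-assoc f g h zero    = *-assoc (f 0) (g 0) (h 0)
⊛-assoc f g h (suc m) = begin
  ((∂ f ⊛ g ⊕ f ⊛ ∂ g) ⊛ h) m + (f ⊛ g ⊛ ∂ h) m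
    ≡⟨ cong (_+ (f ⊛ g ⊛ ∂ h) m) (⊛-distribʳ-⊕ h (∂ f ⊛ g) (f ⊛ ∂ g) m) ⟩
  (∂ f ⊛ g ⊛ h) m + (f ⊛ ∂ g ⊛ h) m + (f ⊛ g ⊛ ∂ h) m
    ≡⟨ cong₂ _+_ (cong₂ _+_ (⊛-assoc (∂ f) g h m) (⊛-assoc f (∂ g) h m))
                 (⊛-assoc f g (∂ h) m) ⟩
  (∂ f ⊛ (g ⊛ h)) m + (f ⊛ (∂ g ⊛ h)) m + (f ⊛ (g ⊛ ∂ h)) m
    ≡⟨ +-assoc ((∂ f ⊛ (g ⊛ h)) m) _ _ ⟩
  (∂ f ⊛ (g ⊛ h)) m + ((f ⊛ (∂ g ⊛ h)) m + (f ⊛ (g ⊛ ∂ h)) m)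
    ≡⟨ cong ((∂ f ⊛ (g ⊛ h)) m +_) (⊛-distribˡ-⊕ f (∂ g ⊛ h) (g ⊛ ∂ h) m) ⟨
  (∂ f ⊛ (g ⊛ h)) m + (f ⊛ (∂ g ⊛ h ⊕ g ⊛ ∂ h)) m
    ∎

⊛-sumTo : ∀ N m f (c : ℕ → ℚ) (G : ℕ → Seq) →
          (f ⊛ (λ k → sumTo N (λ n → c n * G n k))) m ≡ sumTo N (λ n → c n * (f ⊛ G n) m)
⊛-sumTo zero    m f c G = ⊛-scalarʳ f (c 0) (G 0) m
⊛-sumTo (suc N) m f c G = trans (⊛-distribˡ-⊕ f _ (c (suc N) · G (suc N)) m)
  (cong₂ _+_ (⊛-sumTo N m f c G) (⊛-scalarʳ f (c (suc N)) (G (suc N)) m))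

coeff : Seq → Seq
coeff f j = f j * invFact j

coeff-∂ : ∀ f j → coeff (∂ f) j ≡ ι (suc j) * coeff f (suc j)
coeff-∂ f j = begin
  f (suc j) * invFact j
    ≡⟨ cong (f (suc j) *_) (invFact-suc j) ⟨
  f (suc j) * (invFact (suc j) * ι (suc j))
    ≡⟨ solve 3 (λ x i n → x :* (i :* n) := n :* (x :* i))
             refl (f (suc j)) (invFact (suc j)) (ι (suc j)) ⟩
  ι (suc j) * coeff f (suc j)
    ∎
  where open ℚ-Solver.+-*-Solver

sumTo-weights : ∀ n (t : ℕ → ℚ) →
                sumTo n (λ k → ι (n ∸ k) * t k) + sumTo n (λ k → ι k * t k) ≡ ι n * sumTo n t
sumTo-weights n t = begin
  sumTo n (λ k → ι (n ∸ k) * t k) + sumTo n (λ k → ι k * t k) ≡⟨ sumTo-+ n _ _ ⟨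
  sumTo n (λ k → ι (n ∸ k) * t k + ι k * t k)                 ≡⟨ sumTo-cong n weights-add-up ⟩
  sumTo n (λ k → ι n * t k)                                   ≡⟨ sumTo-* n (ι n) t ⟩
  ι n * sumTo n t                                             ∎
  where
  weights-add-up : ∀ k → k ≤ n → ι (n ∸ k) * t k + ι k * t k ≡ ι n * t k
  weights-add-up k k≤n = begin
    ι (n ∸ k) * t k + ι k * t k ≡⟨ *-distribʳ-+ (t k) (ι (n ∸ k)) (ι k) ⟨
    (ι (n ∸ k) + ι k) * t k     ≡⟨ cong (_* t k) (ι-homo-+ (n ∸ k) k) ⟨
    ι (n ∸ k ℕ.+ k) * t k       ≡⟨ cong (λ i → ι i * t k) (ℕₚ.m∸n+n≡m k≤n) ⟩
    ι n * t k                   ∎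

sumTo-coeff-∂ˡ : ∀ m f g → sumTo m (λ k → coeff (∂ f) (m ∸ k) * coeff g k)
                         ≡ sumTo (suc m) (λ k → ι (suc m ∸ k) * (coeff f (suc m ∸ k) * coeff g k))
sumTo-coeff-∂ˡ m f g = begin
  sumTo m (λ k → coeff (∂ f) (m ∸ k) * coeff g k)
    ≡⟨ sumTo-cong m term ⟩
  sumTo m t
    ≡⟨ +-identityʳ (sumTo m t) ⟨
  sumTo m t + 0ℚ
    ≡⟨ cong (sumTo m t +_) (*-zeroˡ (coeff f 0 * coeff g (suc m))) ⟨
  sumTo m t + ι 0 * (coeff f 0 * coeff g (suc m))
    ≡⟨ cong (λ i → sumTo m t + ι i * (coeff f i * coeff g (suc m))) (ℕₚ.n∸n≡0 m) ⟨
  sumTo (suc m) t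
    ∎
  where
  t : ℕ → ℚ
  t k = ι (suc m ∸ k) * (coeff f (suc m ∸ k) * coeff g k)
  term : ∀ k → k ≤ m → coeff (∂ f) (m ∸ k) * coeff g k ≡ t k
  term k k≤m rewrite ℕₚ.+-∸-assoc 1 k≤m =
    trans (cong (_* coeff g k) (coeff-∂ f (m ∸ k))) (*-assoc (ι (suc (m ∸ k))) _ _)

sumTo-coeff-∂ʳ : ∀ m f g → sumTo m (λ k → coeff f (m ∸ k) * coeff (∂ g) k)
                         ≡ sumTo (suc m) (λ k → ι k * (coeff f (suc m ∸ k) * coeff g k))
sumTo-coeff-∂ʳ m f g = begin
  sumTo m (λ k → coeff f (m ∸ k) * coeff (∂ g) k)
    ≡⟨ sumTo-cong m term ⟩
  sumTo m (λ k → t (suc k))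
    ≡⟨ +-identityˡ _ ⟨
  0ℚ + sumTo m (λ k → t (suc k))
    ≡⟨ cong (_+ sumTo m (λ k → t (suc k))) (*-zeroˡ (coeff f (suc m) * coeff g 0)) ⟨
  t 0 + sumTo m (λ k → t (suc k))
    ≡⟨ sumTo-shift m t ⟨
  sumTo (suc m) t
    ∎
  where
  t : ℕ → ℚ
  t k = ι k * (coeff f (suc m ∸ k) * coeff g k)
  term : ∀ k → k ≤ m → coeff f (m ∸ k) * coeff (∂ g) k ≡ t (suc k)
  term k _ = begin
    coeff f (m ∸ k) * coeff (∂ g) k
      ≡⟨ cong (coeff f (m ∸ k) *_) (coeff-∂ g k) ⟩
    coeff f (m ∸ k) * (ι (suc k) * coeff g (suc k))
      ≡⟨ solve 3 (λ x i y → x :* (i :* y) := i :* (x :* y))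
               refl (coeff f (m ∸ k)) (ι (suc k)) (coeff g (suc k)) ⟩
    ι (suc k) * (coeff f (m ∸ k) * coeff g (suc k))
      ∎
    where open ℚ-Solver.+-*-Solver

coeff-⊛ : ∀ f g m → coeff (f ⊛ g) m ≡ sumTo m (λ k → coeff f (m ∸ k) * coeff g k)
coeff-⊛ f g zero    =
  solve 2 (λ x y → x :* y :* con 1ℚ := x :* con 1ℚ :* (y :* con 1ℚ)) refl (f 0) (g 0)
  where open ℚ-Solver.+-*-Solver
coeff-⊛ f g (suc m) = *-cancelʳ-ι _ _ (suc m) (begin
  (f ⊛ g) (suc m) * invFact (suc m) * ι (suc m)
    ≡⟨ *-assoc ((f ⊛ g) (suc m)) _ _ ⟩
  (f ⊛ g) (suc m) * (invFact (suc m) * ι (suc m))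
    ≡⟨ cong ((f ⊛ g) (suc m) *_) (invFact-suc m) ⟩
  ((∂ f ⊛ g) m + (f ⊛ ∂ g) m) * invFact m
    ≡⟨ *-distribʳ-+ (invFact m) ((∂ f ⊛ g) m) ((f ⊛ ∂ g) m) ⟩
  coeff (∂ f ⊛ g) m + coeff (f ⊛ ∂ g) m
    ≡⟨ cong₂ _+_ (coeff-⊛ (∂ f) g m) (coeff-⊛ f (∂ g) m) ⟩
  sumTo m (λ k → coeff (∂ f) (m ∸ k) * coeff g k)
    + sumTo m (λ k → coeff f (m ∸ k) * coeff (∂ g) k)
    ≡⟨ cong₂ _+_ (sumTo-coeff-∂ˡ m f g) (sumTo-coeff-∂ʳ m f g) ⟩
  sumTo (suc m) (λ k → ι (suc m ∸ k) * t k) + sumTo (suc m) (λ k → ι k * t k)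
    ≡⟨ sumTo-weights (suc m) t ⟩
  ι (suc m) * sumTo (suc m) t
    ≡⟨ *-comm (ι (suc m)) _ ⟩
  sumTo (suc m) t * ι (suc m)
    ∎)
  where
  t : ℕ → ℚ
  t k = coeff f (suc m ∸ k) * coeff g k

-- Once z vanishes below m, the EGF coefficient of t^(m+1) in w ⊛ z is w₁ · z_m / m!.
w⊛z≗0⇒z≗0 : ∀ {w z} → w 0 ≡ 0ℚ → w 1 ≢ 0ℚ → w ⊛ z ≗ const 0ℚ → z ≗ const 0ℚ
w⊛z≗0⇒z≗0 {w} {z} w₀≡0 w₁≢0 w⊛z≡0 = <-rec (λ m → z m ≡ 0ℚ) vanishes
  where
  instance _ = ≢-nonZero w₁≢0
  vanishes : ∀ m → (∀ {k} → k < m → z k ≡ 0ℚ) → z m ≡ 0ℚ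
  vanishes m z<m≡0 = *-cancelʳ-≡ (z m) 0ℚ (ι (m !)) (invFact*n!≡1 m) (trans
    (*-cancelʳ-≡ (coeff z m) 0ℚ (1/ w 1) (*-inverseʳ (w 1)) leading≡0) (sym (*-zeroˡ (invFact m))))
    where
    t : ℕ → ℚ
    t k = coeff w (suc m ∸ k) * coeff z k
    t<m≡0 : ∀ k → k < m → t k ≡ 0ℚ
    t<m≡0 k k<m = begin
      coeff w (suc m ∸ k) * (z k * invFact k)
        ≡⟨ cong (λ x → coeff w (suc m ∸ k) * (x * invFact k)) (z<m≡0 k<m) ⟩
      coeff w (suc m ∸ k) * (0ℚ * invFact k)
        ≡⟨ cong (coeff w (suc m ∸ k) *_) (*-zeroˡ (invFact k)) ⟩
      coeff w (suc m ∸ k) * 0ℚ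
        ≡⟨ *-zeroʳ (coeff w (suc m ∸ k)) ⟩
      0ℚ
        ∎
    last≡0 : t (suc m) ≡ 0ℚ
    last≡0 = begin
      coeff w (m ∸ m) * coeff z (suc m)
        ≡⟨ cong (λ i → coeff w i * coeff z (suc m)) (ℕₚ.n∸n≡0 m) ⟩
      w 0 * invFact 0 * coeff z (suc m)
        ≡⟨ cong (λ x → x * invFact 0 * coeff z (suc m)) w₀≡0 ⟩
      0ℚ * coeff z (suc m)
        ≡⟨ *-zeroˡ (coeff z (suc m)) ⟩
      0ℚ
        ∎
    leading≡0 : coeff z m * w 1 ≡ 0ℚ * w 1
    leading≡0 = begin
      coeff z m * w 1
        ≡⟨ solve 2 (λ x y → x :* y := y :* con 1ℚ :* x :+ con 0ℚ) refl (coeff z m) (w 1) ⟩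
      coeff w 1 * coeff z m + 0ℚ
        ≡⟨ cong₂ (λ i x → coeff w i * coeff z m + x) (ℕₚ.m+n∸n≡m 1 m) last≡0 ⟨
      t m + t (suc m)
        ≡⟨ cong (_+ t (suc m)) (sumTo-last m t<m≡0) ⟨
      sumTo m t + t (suc m)
        ≡⟨ coeff-⊛ w z (suc m) ⟨
      coeff (w ⊛ z) (suc m)
        ≡⟨ cong (_* invFact (suc m)) (w⊛z≡0 (suc m)) ⟩
      0ℚ * invFact (suc m)
        ≡⟨ *-zeroˡ (invFact (suc m)) ⟩
      0ℚ
        ≡⟨ *-zeroˡ (w 1) ⟨
      0ℚ * w 1
        ∎
      where open ℚ-Solver.+-*-Solver

⊛-cancelˡ : ∀ {w f g} → w 0 ≡ 0ℚ → w 1 ≢ 0ℚ → w ⊛ f ≗ w ⊛ g → f ≗ g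
⊛-cancelˡ {w} {f} {g} w₀≡0 w₁≢0 w⊛f≗w⊛g m = begin
  f m                        ≡⟨ solve 2 (λ x y → x := x :+ con (- 1ℚ) :* y :+ y) refl (f m) (g m) ⟩
  (f ⊕ (- 1ℚ) · g) m + g m   ≡⟨ cong (_+ g m) (w⊛z≗0⇒z≗0 w₀≡0 w₁≢0 w⊛difference≡0 m) ⟩
  0ℚ + g m                   ≡⟨ +-identityˡ (g m) ⟩
  g m                        ∎
  where
  open ℚ-Solver.+-*-Solver
  w⊛difference≡0 : ∀ m → (w ⊛ (f ⊕ (- 1ℚ) · g)) m ≡ 0ℚ
  w⊛difference≡0 m = begin
    (w ⊛ (f ⊕ (- 1ℚ) · g)) m
      ≡⟨ ⊛-distribˡ-⊕ w f ((- 1ℚ) · g) m ⟩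
    (w ⊛ f) m + (w ⊛ (- 1ℚ) · g) m
      ≡⟨ cong ((w ⊛ f) m +_) (⊛-scalarʳ w (- 1ℚ) g m) ⟩
    (w ⊛ f) m + - 1ℚ * (w ⊛ g) m
      ≡⟨ cong (λ x → x + - 1ℚ * (w ⊛ g) m) (w⊛f≗w⊛g m) ⟩
    (w ⊛ g) m + - 1ℚ * (w ⊛ g) m
      ≡⟨ solve 1 (λ x → x :+ con (- 1ℚ) :* x := con 0ℚ) refl ((w ⊛ g) m) ⟩
    0ℚ
      ∎

eᵗ : Seq
eᵗ _ = 1ℚ

eᵗ-1 : Seq
eᵗ-1 zero    = 0ℚ
eᵗ-1 (suc _) = 1ℚ

eᵗ+1 : Seq
eᵗ+1 = eᵗ ⊕ δ

eᵗ⊛eᵗ : ∀ m → (eᵗ ⊛ eᵗ) m ≡ ι (2 ^ m)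
eᵗ⊛eᵗ zero    = refl
eᵗ⊛eᵗ (suc m) = begin
  (eᵗ ⊛ eᵗ) m + (eᵗ ⊛ eᵗ) m   ≡⟨ cong₂ _+_ (eᵗ⊛eᵗ m) (eᵗ⊛eᵗ m) ⟩
  ι (2 ^ m) + ι (2 ^ m)       ≡⟨ ι-homo-+ (2 ^ m) (2 ^ m) ⟨
  ι (2 ^ m ℕ.+ 2 ^ m)         ≡⟨ cong (λ n → ι (2 ^ m ℕ.+ n)) (ℕₚ.+-identityʳ (2 ^ m)) ⟨
  ι (2 ^ suc m)               ∎

eᵗ+1⊛euler : ∀ {E} → IsEulerSeq E → eᵗ+1 ⊛ E ≗ ι 2 · δ
eᵗ+1⊛euler {E} isEuler m = *-cancelʳ-≡ _ _ (ι (m !)) (invFact*n!≡1 m) (begin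
  (eᵗ+1 ⊛ E) m * invFact m
    ≡⟨ cong (_* invFact m) (⊛-distribʳ-⊕ E eᵗ δ m) ⟩
  ((eᵗ ⊛ E) m + (δ ⊛ E) m) * invFact m
    ≡⟨ cong (λ x → ((eᵗ ⊛ E) m + x) * invFact m) (⊛-identityˡ E m) ⟩
  ((eᵗ ⊛ E) m + E m) * invFact m
    ≡⟨ *-distribʳ-+ (invFact m) ((eᵗ ⊛ E) m) (E m) ⟩
  coeff (eᵗ ⊛ E) m + E m * invFact m
    ≡⟨ cong (_+ E m * invFact m) (coeff-⊛ eᵗ E m) ⟩
  sumTo m (λ k → (1ℚ * invFact (m ∸ k)) * coeff E k) + E m * invFact m
    ≡⟨ cong (_+ E m * invFact m) (sumTo-cong m (λ k _ → cong (_* coeff E k) (*-identityˡ (invFact (m ∸ k))))) ⟩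
  sumTo m (λ k → invFact (m ∸ k) * (E k * invFact k)) + E m * invFact m
    ≡⟨ isEuler m ⟩
  (if m ℕ.≡ᵇ 0 then ι 2 else 0ℚ)
    ≡⟨ two-δ m ⟩
  ι 2 * δ m * invFact m
    ∎)
  where
  two-δ : ∀ m → (if m ℕ.≡ᵇ 0 then ι 2 else 0ℚ) ≡ ι 2 * δ m * invFact m
  two-δ zero    = refl
  two-δ (suc m) = sym (*-zeroˡ (invFact (suc m)))

S₂-vanishes : ∀ {m n} → m < n → S₂ m n ≡ 0
S₂-vanishes {zero}  {suc n} _         = refl
S₂-vanishes {suc m} {suc n} (s≤s m<n)
  rewrite S₂-vanishes {m} {suc n} (ℕₚ.m≤n⇒m≤1+n m<n) | S₂-vanishes m<n =
    trans (ℕₚ.+-identityʳ (n ℕ.* 0)) (ℕₚ.*-zeroʳ n)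

S₂[1+m,1]≡1 : ∀ m → S₂ (suc m) 1 ≡ 1
S₂[1+m,1]≡1 zero    = refl
S₂[1+m,1]≡1 (suc m) rewrite S₂[1+m,1]≡1 m = refl

-- X^ n is the EGF (e^{2t} − 1)^n: its coefficients are 2^m times the number n! S₂(m,n)
-- of surjections from an m-set onto an n-set.
X^_ : ℕ → Seq
(X^ n) m = ι (2 ^ m ℕ.* (n ! ℕ.* S₂ m n))

X : Seq
X = X^ 1

X^-vanishes : ∀ {m} n → m < n → (X^ n) m ≡ 0ℚ
X^-vanishes {m} n m<n rewrite S₂-vanishes m<n | ℕₚ.*-zeroʳ (n !) | ℕₚ.*-zeroʳ (2 ^ m) = refl

X^0≗δ : X^ 0 ≗ δ
X^0≗δ zero    = refl
X^0≗δ (suc m) rewrite ℕₚ.*-zeroʳ (2 ^ suc m) = refl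

-- The chain rule ∂ (X^(n+1)) = (n + 1) X^n ∂X with ∂X = 2 e^{2t} = 2 (X + 1), read off the
-- recurrence of S₂.
∂X^suc : ∀ n → ∂ (X^ suc n) ≗ ι (2 ℕ.* suc n) · (X^ suc n ⊕ X^ n)
∂X^suc n m = begin
  ι (2 ^ suc m ℕ.* (suc n ! ℕ.* S₂ (suc m) (suc n)))
    ≡⟨ cong ι recurrence ⟩
  ι (2 ℕ.* suc n ℕ.* (X₁ ℕ.+ X₀))
    ≡⟨ ι-homo-* (2 ℕ.* suc n) (X₁ ℕ.+ X₀) ⟩
  ι (2 ℕ.* suc n) * ι (X₁ ℕ.+ X₀)
    ≡⟨ cong (ι (2 ℕ.* suc n) *_) (ι-homo-+ X₁ X₀) ⟩
  ι (2 ℕ.* suc n) * ((X^ suc n) m + (X^ n) m)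
    ∎
  where
  X₁ = 2 ^ m ℕ.* (suc n ! ℕ.* S₂ m (suc n))
  X₀ = 2 ^ m ℕ.* (n ! ℕ.* S₂ m n)
  recurrence : 2 ^ suc m ℕ.* (suc n ! ℕ.* S₂ (suc m) (suc n)) ≡ 2 ℕ.* suc n ℕ.* (X₁ ℕ.+ X₀)
  recurrence = solve 5
    (λ p f s₁ s₀ n → (con 2 :* p) :* (((con 1 :+ n) :* f) :* ((con 1 :+ n) :* s₁ :+ s₀))
                  := (con 2 :* (con 1 :+ n)) :* (p :* (((con 1 :+ n) :* f) :* s₁) :+ p :* (f :* s₀)))
    refl (2 ^ m) (n !) (S₂ m (suc n)) (S₂ m n) n
    where open ℕ-Solver.+-*-Solver

∂X⊛ : ∀ f m → (∂ X ⊛ f) m ≡ ι 2 * ((X ⊛ f) m + f m)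
∂X⊛ f m = begin
  (∂ X ⊛ f) m
    ≡⟨ ⊛-congˡ f (∂X^suc 0) m ⟩
  (ι 2 · (X ⊕ X^ 0) ⊛ f) m
    ≡⟨ ⊛-scalarˡ (ι 2) (X ⊕ X^ 0) f m ⟩
  ι 2 * ((X ⊕ X^ 0) ⊛ f) m
    ≡⟨ cong (ι 2 *_) (⊛-distribʳ-⊕ f X (X^ 0) m) ⟩
  ι 2 * ((X ⊛ f) m + (X^ 0 ⊛ f) m)
    ≡⟨ cong (λ x → ι 2 * ((X ⊛ f) m + x)) (trans (⊛-congˡ f X^0≗δ m) (⊛-identityˡ f m)) ⟩
  ι 2 * ((X ⊛ f) m + f m)
    ∎

X⊛∂X^suc : ∀ n m →
           (X ⊛ ∂ (X^ suc n)) m ≡ ι (2 ℕ.* suc n) * ((X ⊛ X^ suc n) m + (X ⊛ X^ n) m)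
X⊛∂X^suc n m = begin
  (X ⊛ ∂ (X^ suc n)) m
    ≡⟨ ⊛-congʳ X (∂X^suc n) m ⟩
  (X ⊛ ι (2 ℕ.* suc n) · (X^ suc n ⊕ X^ n)) m
    ≡⟨ ⊛-scalarʳ X (ι (2 ℕ.* suc n)) (X^ suc n ⊕ X^ n) m ⟩
  ι (2 ℕ.* suc n) * (X ⊛ (X^ suc n ⊕ X^ n)) m
    ≡⟨ cong (ι (2 ℕ.* suc n) *_) (⊛-distribˡ-⊕ X (X^ suc n) (X^ n) m) ⟩
  ι (2 ℕ.* suc n) * ((X ⊛ X^ suc n) m + (X ⊛ X^ n) m)
    ∎

X⊛X^ : ∀ n → X ⊛ X^ n ≗ X^ suc n
X⊛X^ zero    m       = trans (⊛-congʳ X X^0≗δ m) (⊛-identityʳ X m)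
X⊛X^ (suc n) zero    = trans (*-zeroˡ ((X^ suc n) 0)) (sym (X^-vanishes (suc (suc n)) (s≤s z≤n)))
X⊛X^ (suc n) (suc m) = begin
  (∂ X ⊛ X^ suc n) m + (X ⊛ ∂ (X^ suc n)) m
    ≡⟨ cong₂ _+_ (∂X⊛ (X^ suc n) m) (X⊛∂X^suc n m) ⟩
  ι 2 * ((X ⊛ X^ suc n) m + (X^ suc n) m) + ι (2 ℕ.* suc n) * ((X ⊛ X^ suc n) m + (X ⊛ X^ n) m)
    ≡⟨ cong₂ (λ x y → ι 2 * (x + (X^ suc n) m) + ι (2 ℕ.* suc n) * (x + y))
             (X⊛X^ (suc n) m) (X⊛X^ n m) ⟩
  ι 2 * Y + ι (2 ℕ.* suc n) * Y
    ≡⟨ *-distribʳ-+ Y (ι 2) (ι (2 ℕ.* suc n)) ⟨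
  (ι 2 + ι (2 ℕ.* suc n)) * Y
    ≡⟨ cong (_* Y) (trans (cong ι (ℕₚ.*-suc 2 (suc n))) (ι-homo-+ 2 (2 ℕ.* suc n))) ⟨
  ι (2 ℕ.* suc (suc n)) * Y
    ≡⟨ ∂X^suc (suc n) m ⟨
  (X^ suc (suc n)) (suc m)
    ∎
  where
  Y = (X^ suc (suc n)) m + (X^ suc n) m

X≗eᵗ-1⊛eᵗ+1 : X ≗ eᵗ-1 ⊛ eᵗ+1
X≗eᵗ-1⊛eᵗ+1 zero    = refl
X≗eᵗ-1⊛eᵗ+1 (suc m) = sym (begin
  (eᵗ-1 ⊛ (eᵗ ⊕ δ)) (suc m)
    ≡⟨ ⊛-distribˡ-⊕ eᵗ-1 eᵗ δ (suc m) ⟩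
  (eᵗ-1 ⊛ eᵗ) (suc m) + (eᵗ-1 ⊛ δ) (suc m)
    ≡⟨ cong₂ _+_ eᵗ-1⊛eᵗ (⊛-identityʳ eᵗ-1 (suc m)) ⟩
  (ι (2 ^ suc m) + - 1ℚ * 1ℚ) + 1ℚ
    ≡⟨ solve 1 (λ x → x :+ con (- 1ℚ) :* con 1ℚ :+ con 1ℚ := x) refl (ι (2 ^ suc m)) ⟩
  ι (2 ^ suc m)
    ≡⟨ cong ι (ℕₚ.*-identityʳ (2 ^ suc m)) ⟨
  ι (2 ^ suc m ℕ.* 1)
    ≡⟨ cong (λ s → ι (2 ^ suc m ℕ.* (1 ℕ.* s))) (S₂[1+m,1]≡1 m) ⟨
  X (suc m)
    ∎)
  where
  open ℚ-Solver.+-*-Solver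
  eᵗ-1≗eᵗ-δ : eᵗ-1 ≗ eᵗ ⊕ (- 1ℚ) · δ
  eᵗ-1≗eᵗ-δ zero    = refl
  eᵗ-1≗eᵗ-δ (suc _) = refl
  eᵗ-1⊛eᵗ : (eᵗ-1 ⊛ eᵗ) (suc m) ≡ ι (2 ^ suc m) + - 1ℚ * 1ℚ
  eᵗ-1⊛eᵗ = begin
    (eᵗ-1 ⊛ eᵗ) (suc m)
      ≡⟨ ⊛-congˡ eᵗ eᵗ-1≗eᵗ-δ (suc m) ⟩
    ((eᵗ ⊕ (- 1ℚ) · δ) ⊛ eᵗ) (suc m)
      ≡⟨ ⊛-distribʳ-⊕ eᵗ eᵗ ((- 1ℚ) · δ) (suc m) ⟩
    (eᵗ ⊛ eᵗ) (suc m) + ((- 1ℚ) · δ ⊛ eᵗ) (suc m)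
      ≡⟨ cong₂ _+_ (eᵗ⊛eᵗ (suc m)) (⊛-scalarˡ (- 1ℚ) δ eᵗ (suc m)) ⟩
    ι (2 ^ suc m) + - 1ℚ * (δ ⊛ eᵗ) (suc m)
      ≡⟨ cong (λ x → ι (2 ^ suc m) + - 1ℚ * x) (⊛-identityˡ eᵗ (suc m)) ⟩
    ι (2 ^ suc m) + - 1ℚ * 1ℚ
      ∎

X⊛euler : ∀ {E} → IsEulerSeq E → X ⊛ E ≗ ι 2 · eᵗ-1
X⊛euler {E} isEuler m = begin
  (X ⊛ E) m                  ≡⟨ ⊛-congˡ E X≗eᵗ-1⊛eᵗ+1 m ⟩
  (eᵗ-1 ⊛ eᵗ+1 ⊛ E) m        ≡⟨ ⊛-assoc eᵗ-1 eᵗ+1 E m ⟩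
  (eᵗ-1 ⊛ (eᵗ+1 ⊛ E)) m      ≡⟨ ⊛-congʳ eᵗ-1 (eᵗ+1⊛euler isEuler) m ⟩
  (eᵗ-1 ⊛ ι 2 · δ) m         ≡⟨ ⊛-scalarʳ eᵗ-1 (ι 2) δ m ⟩
  ι 2 * (eᵗ-1 ⊛ δ) m         ≡⟨ cong (ι 2 *_) (⊛-identityʳ eᵗ-1 m) ⟩
  ι 2 * eᵗ-1 m               ∎

absorption : ∀ n k → suc k ℕ.* (suc n C suc k) ≡ suc n ℕ.* (n C k)
absorption zero    zero    = refl
absorption zero    (suc k) = ℕₚ.*-zeroʳ (2 ℕ.+ k)
absorption (suc n) zero    =
  trans (ℕₚ.*-identityˡ _) (trans (nC1≡n (2 ℕ.+ n)) (sym (ℕₚ.*-identityʳ (2 ℕ.+ n))))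
absorption (suc n) (suc k) = begin
  (2 ℕ.+ k) ℕ.* ((2 ℕ.+ n) C (2 ℕ.+ k))
    ≡⟨ cong ((2 ℕ.+ k) ℕ.*_) (nCk+nC[k+1]≡[n+1]C[k+1] (suc n) (suc k)) ⟨
  (2 ℕ.+ k) ℕ.* (P ℕ.+ Q)
    ≡⟨ solve 3 (λ k P Q → (con 2 :+ k) :* (P :+ Q) := (con 1 :+ k) :* P :+ (con 2 :+ k) :* Q :+ P) refl k P Q ⟩
  suc k ℕ.* P ℕ.+ (2 ℕ.+ k) ℕ.* Q ℕ.+ P
    ≡⟨ cong (ℕ._+ P) (cong₂ ℕ._+_ (absorption n k) (absorption n (suc k))) ⟩
  suc n ℕ.* (n C k) ℕ.+ suc n ℕ.* (n C suc k) ℕ.+ P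
    ≡⟨ cong (ℕ._+ P) (ℕₚ.*-distribˡ-+ (suc n) (n C k) (n C suc k)) ⟨
  suc n ℕ.* (n C k ℕ.+ n C suc k) ℕ.+ P
    ≡⟨ cong (λ x → suc n ℕ.* x ℕ.+ P) (nCk+nC[k+1]≡[n+1]C[k+1] n k) ⟩
  suc n ℕ.* P ℕ.+ P
    ≡⟨ ℕₚ.+-comm (suc n ℕ.* P) P ⟩
  (2 ℕ.+ n) ℕ.* P
    ∎
  where
  open ℕ-Solver.+-*-Solver
  P = suc n C suc k
  Q = suc n C (2 ℕ.+ k)

centralBinomial-rec : ∀ n →
  suc n ℕ.* ((2 ℕ.* suc n) C suc n) ≡ 2 ℕ.* suc (2 ℕ.* n) ℕ.* ((2 ℕ.* n) C n)
centralBinomial-rec n = begin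
  suc n ℕ.* ((2 ℕ.* suc n) C suc n)
    ≡⟨ cong (λ t → suc n ℕ.* (t C suc n)) (ℕₚ.*-suc 2 n) ⟩
  suc n ℕ.* ((2 ℕ.+ 2 ℕ.* n) C suc n)
    ≡⟨ cong (suc n ℕ.*_) (nCk+nC[k+1]≡[n+1]C[k+1] (suc (2 ℕ.* n)) n) ⟨
  suc n ℕ.* (suc (2 ℕ.* n) C n ℕ.+ R)
    ≡⟨ cong (λ x → suc n ℕ.* (x ℕ.+ R)) symmetric ⟩
  suc n ℕ.* (R ℕ.+ R)
    ≡⟨ solve 2 (λ n R → (con 1 :+ n) :* (R :+ R) := con 2 :* ((con 1 :+ n) :* R)) refl n R ⟩
  2 ℕ.* (suc n ℕ.* R)
    ≡⟨ cong (2 ℕ.*_) (absorption (2 ℕ.* n) n) ⟩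
  2 ℕ.* (suc (2 ℕ.* n) ℕ.* ((2 ℕ.* n) C n))
    ≡⟨ ℕₚ.*-assoc 2 (suc (2 ℕ.* n)) _ ⟨
  2 ℕ.* suc (2 ℕ.* n) ℕ.* ((2 ℕ.* n) C n)
    ∎
  where
  open ℕ-Solver.+-*-Solver
  R = suc (2 ℕ.* n) C suc n
  n≤2n : n ≤ 2 ℕ.* n
  n≤2n = ℕₚ.m≤m+n n (n ℕ.+ 0)
  [1+2n]∸n≡1+n : suc (2 ℕ.* n) ∸ n ≡ suc n
  [1+2n]∸n≡1+n =
    trans (ℕₚ.+-∸-assoc 1 n≤2n) (cong suc (trans (ℕₚ.m+n∸m≡n n (n ℕ.+ 0)) (ℕₚ.+-identityʳ n)))
  symmetric : suc (2 ℕ.* n) C n ≡ R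
  symmetric = trans (nCk≡nC[n∸k] (ℕₚ.m≤n⇒m≤1+n n≤2n)) (cong (suc (2 ℕ.* n) C_) [1+2n]∸n≡1+n)

catalan*[1+n]≡[2n]Cn : ∀ n → catalan n * ι (suc n) ≡ ι ((2 ℕ.* n) C n)
catalan*[1+n]≡[2n]Cn n = begin
  catalan n * ι (suc n)
    ≡⟨ cong (_* ι (suc n)) (m/n≡ιm*1/n ((2 ℕ.* n) C n) (suc n)) ⟩
  ι ((2 ℕ.* n) C n) * (ℤ.+ 1 / suc n) * ι (suc n)
    ≡⟨ *-assoc (ι ((2 ℕ.* n) C n)) _ _ ⟩
  ι ((2 ℕ.* n) C n) * ((ℤ.+ 1 / suc n) * ι (suc n))
    ≡⟨ cong (ι ((2 ℕ.* n) C n) *_) (1/n*ιn≡1 (suc n)) ⟩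
  ι ((2 ℕ.* n) C n) * 1ℚ
    ≡⟨ *-identityʳ _ ⟩
  ι ((2 ℕ.* n) C n)
    ∎

catalan-rec : ∀ n → catalan (suc n) * ι (2 ℕ.+ n) ≡ ι 2 * ι (suc (2 ℕ.* n)) * catalan n
catalan-rec n = *-cancelʳ-ι _ _ (suc n) (begin
  catalan (suc n) * ι (2 ℕ.+ n) * ι (suc n)
    ≡⟨ cong (_* ι (suc n)) (catalan*[1+n]≡[2n]Cn (suc n)) ⟩
  ι ((2 ℕ.* suc n) C suc n) * ι (suc n)
    ≡⟨ ι-homo-* ((2 ℕ.* suc n) C suc n) (suc n) ⟨
  ι (((2 ℕ.* suc n) C suc n) ℕ.* suc n)
    ≡⟨ cong ι (trans (ℕₚ.*-comm _ (suc n)) (centralBinomial-rec n)) ⟩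
  ι (2 ℕ.* suc (2 ℕ.* n) ℕ.* ((2 ℕ.* n) C n))
    ≡⟨ trans (ι-homo-* (2 ℕ.* suc (2 ℕ.* n)) ((2 ℕ.* n) C n))
             (cong (_* ι ((2 ℕ.* n) C n)) (ι-homo-* 2 (suc (2 ℕ.* n)))) ⟩
  ι 2 * ι (suc (2 ℕ.* n)) * ι ((2 ℕ.* n) C n)
    ≡⟨ cong (ι 2 * ι (suc (2 ℕ.* n)) *_) (catalan*[1+n]≡[2n]Cn n) ⟨
  ι 2 * ι (suc (2 ℕ.* n)) * (catalan n * ι (suc n))
    ≡⟨ *-assoc (ι 2 * ι (suc (2 ℕ.* n))) _ _ ⟨
  ι 2 * ι (suc (2 ℕ.* n)) * catalan n * ι (suc n)
    ∎)

¼ : ℚ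
¼ = ℤ.+ 1 / 4

¼^n*ι4^n≡1 : ∀ n → ¼ ^ℚ n * ι (4 ^ n) ≡ 1ℚ
¼^n*ι4^n≡1 zero    = refl
¼^n*ι4^n≡1 (suc n) = begin
  ¼ * ¼ ^ℚ n * ι (4 ℕ.* 4 ^ n)
    ≡⟨ cong (¼ * ¼ ^ℚ n *_) (ι-homo-* 4 (4 ^ n)) ⟩
  ¼ * ¼ ^ℚ n * (ι 4 * ι (4 ^ n))
    ≡⟨ solve 4 (λ a b c d → a :* b :* (c :* d) := (a :* c) :* (b :* d))
             refl ¼ (¼ ^ℚ n) (ι 4) (ι (4 ^ n)) ⟩
  ¼ * ι 4 * (¼ ^ℚ n * ι (4 ^ n))
    ≡⟨ cong (¼ * ι 4 *_) (¼^n*ι4^n≡1 n) ⟩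
  1ℚ
    ∎
  where open ℚ-Solver.+-*-Solver

ι2^[k+2n]*¼^n≡ι2^k : ∀ k n → ι (2 ^ (k ℕ.+ 2 ℕ.* n)) * ¼ ^ℚ n ≡ ι (2 ^ k)
ι2^[k+2n]*¼^n≡ι2^k k n = begin
  ι (2 ^ (k ℕ.+ 2 ℕ.* n)) * ¼ ^ℚ n
    ≡⟨ cong (λ p → ι p * ¼ ^ℚ n)
            (trans (ℕₚ.^-distribˡ-+-* 2 k (2 ℕ.* n)) (cong (2 ^ k ℕ.*_) (sym (ℕₚ.^-*-assoc 2 2 n)))) ⟩
  ι (2 ^ k ℕ.* 4 ^ n) * ¼ ^ℚ n
    ≡⟨ cong (_* ¼ ^ℚ n) (ι-homo-* (2 ^ k) (4 ^ n)) ⟩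
  ι (2 ^ k) * ι (4 ^ n) * ¼ ^ℚ n
    ≡⟨ solve 3 (λ a b c → a :* b :* c := a :* (c :* b)) refl (ι (2 ^ k)) (ι (4 ^ n)) (¼ ^ℚ n) ⟩
  ι (2 ^ k) * (¼ ^ℚ n * ι (4 ^ n))
    ≡⟨ cong (ι (2 ^ k) *_) (¼^n*ι4^n≡1 n) ⟩
  ι (2 ^ k) * 1ℚ
    ≡⟨ *-identityʳ _ ⟩
  ι (2 ^ k)
    ∎
  where open ℚ-Solver.+-*-Solver

pow2≡ι2^m*¼^n : ∀ m n → pow2 m n ≡ ι (2 ^ m) * ¼ ^ℚ n
pow2≡ι2^m*¼^n m n with 2 ℕ.* n ≤ᵇ m in 2n≤ᵇm
... | true  = begin
  ι (2 ^ (m ∸ 2 ℕ.* n))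
    ≡⟨ ι2^[k+2n]*¼^n≡ι2^k (m ∸ 2 ℕ.* n) n ⟨
  ι (2 ^ (m ∸ 2 ℕ.* n ℕ.+ 2 ℕ.* n)) * ¼ ^ℚ n
    ≡⟨ cong (λ e → ι (2 ^ e) * ¼ ^ℚ n) (ℕₚ.m∸n+n≡m 2n≤m) ⟩
  ι (2 ^ m) * ¼ ^ℚ n
    ∎
  where
  2n≤m : 2 ℕ.* n ≤ m
  2n≤m = ℕₚ.≤ᵇ⇒≤ (2 ℕ.* n) m (subst T (sym 2n≤ᵇm) tt)
... | false = inverse-unique _ _ (ι (2 ^ d)) (1/n*ιn≡1 (2 ^ d) {{ℕₚ.m^n≢0 2 d}}) (begin
  ι (2 ^ m) * ¼ ^ℚ n * ι (2 ^ d)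
    ≡⟨ solve 3 (λ a b c → a :* b :* c := c :* a :* b) refl (ι (2 ^ m)) (¼ ^ℚ n) (ι (2 ^ d)) ⟩
  ι (2 ^ d) * ι (2 ^ m) * ¼ ^ℚ n
    ≡⟨ cong (_* ¼ ^ℚ n) (trans (cong ι (ℕₚ.^-distribˡ-+-* 2 d m)) (ι-homo-* (2 ^ d) (2 ^ m))) ⟨
  ι (2 ^ (d ℕ.+ m)) * ¼ ^ℚ n
    ≡⟨ cong (λ e → ι (2 ^ e) * ¼ ^ℚ n) (ℕₚ.m∸n+n≡m m≤2n) ⟩
  ι (2 ^ (0 ℕ.+ 2 ℕ.* n)) * ¼ ^ℚ n
    ≡⟨ ι2^[k+2n]*¼^n≡ι2^k 0 n ⟩
  1ℚ
    ∎)
  where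
  open ℚ-Solver.+-*-Solver
  d = 2 ℕ.* n ∸ m
  m≤2n : m ≤ 2 ℕ.* n
  m≤2n = ℕₚ.≰⇒≥ (λ 2n≤m → subst T 2n≤ᵇm (ℕₚ.≤⇒≤ᵇ 2n≤m))

a : ℕ → ℚ
a n = catalan n * sign n * ¼ ^ℚ n

rhs-term : ∀ m n → catalan n * sign n * pow2 m n * ι (n !) * ι (S₂ m n) ≡ a n * (X^ n) m
rhs-term m n = begin
  catalan n * sign n * pow2 m n * ι (n !) * ι (S₂ m n)
    ≡⟨ cong (λ p → catalan n * sign n * p * ι (n !) * ι (S₂ m n)) (pow2≡ι2^m*¼^n m n) ⟩
  catalan n * sign n * (ι (2 ^ m) * ¼ ^ℚ n) * ι (n !) * ι (S₂ m n)
    ≡⟨ solve 6 (λ c s p q f S → c :* s :* (p :* q) :* f :* S := c :* s :* q :* (p :* (f :* S))) refl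
         (catalan n) (sign n) (ι (2 ^ m)) (¼ ^ℚ n) (ι (n !)) (ι (S₂ m n)) ⟩
  a n * (ι (2 ^ m) * (ι (n !) * ι (S₂ m n)))
    ≡⟨ cong (λ x → a n * (ι (2 ^ m) * x)) (ι-homo-* (n !) (S₂ m n)) ⟨
  a n * (ι (2 ^ m) * ι (n ! ℕ.* S₂ m n))
    ≡⟨ cong (a n *_) (ι-homo-* (2 ^ m) (n ! ℕ.* S₂ m n)) ⟨
  a n * (X^ n) m
    ∎
  where open ℚ-Solver.+-*-Solver

rhs≡Σa·X^ : ∀ {m N} → m ≤ N → rhs m ≡ sumTo N (λ n → a n * (X^ n) m)
rhs≡Σa·X^ {m} {N} m≤N = trans (sumTo-cong m (λ n _ → rhs-term m n))
  (sumTo-extend N (λ n m<n → trans (cong (a n *_) (X^-vanishes n m<n)) (*-zeroʳ (a n))) m≤N)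

a-rec : ∀ n → a (suc n) * ι (2 ℕ.* (2 ℕ.+ n)) + a n * ι (suc (2 ℕ.* n)) ≡ 0ℚ
a-rec n = begin
  catalan (suc n) * (- s) * (¼ * q) * ι (2 ℕ.* (2 ℕ.+ n)) + a n * ι (suc (2 ℕ.* n))
    ≡⟨ cong (λ x → catalan (suc n) * (- s) * (¼ * q) * x + a n * ι (suc (2 ℕ.* n)))
            (ι-homo-* 2 (2 ℕ.+ n)) ⟩
  catalan (suc n) * (- s) * (¼ * q) * (ι 2 * ι (2 ℕ.+ n)) + a n * ι (suc (2 ℕ.* n))
    ≡⟨ solve 5 (λ c s q m b → c :* (:- s) :* (con ¼ :* q) :* (con (ι 2) :* m) :+ b
                           := (:- s) :* q :* (con ¼ :* con (ι 2)) :* (c :* m) :+ b)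
         refl (catalan (suc n)) s q (ι (2 ℕ.+ n)) (a n * ι (suc (2 ℕ.* n))) ⟩
  (- s) * q * (¼ * ι 2) * (catalan (suc n) * ι (2 ℕ.+ n)) + a n * ι (suc (2 ℕ.* n))
    ≡⟨ cong (λ x → (- s) * q * (¼ * ι 2) * x + a n * ι (suc (2 ℕ.* n))) (catalan-rec n) ⟩
  (- s) * q * (¼ * ι 2) * (ι 2 * ι (suc (2 ℕ.* n)) * catalan n) + catalan n * s * q * ι (suc (2 ℕ.* n))
    ≡⟨ solve 4 (λ s q o c → (:- s) :* q :* (con ¼ :* con (ι 2)) :* (con (ι 2) :* o :* c) :+ c :* s :* q :* o
                         := con 0ℚ)
         refl s q (ι (suc (2 ℕ.* n))) (catalan n) ⟩
  0ℚ
    ∎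
  where
  open ℚ-Solver.+-*-Solver
  s = sign n
  q = ¼ ^ℚ n

sumTo-telescope : ∀ (b c f : ℕ → ℚ) → (∀ n → c (suc n) + b n ≡ 0ℚ) →
                  ∀ N → sumTo N (λ n → b n * f (suc n) + c n * f n) ≡ c 0 * f 0 + b N * f (suc N)
sumTo-telescope b c f _         zero    = +-comm (b 0 * f 1) (c 0 * f 0)
sumTo-telescope b c f c[1+n]+bn≡0 (suc N) = begin
  sumTo N (λ n → b n * f (suc n) + c n * f n) + (b (suc N) * f (2 ℕ.+ N) + c (suc N) * f (suc N))
    ≡⟨ cong (_+ (b (suc N) * f (2 ℕ.+ N) + c (suc N) * f (suc N)))
            (sumTo-telescope b c f c[1+n]+bn≡0 N) ⟩
  c 0 * f 0 + b N * f (suc N) + (b (suc N) * f (2 ℕ.+ N) + c (suc N) * f (suc N))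
    ≡⟨ solve 7 (λ c₀ f₀ b f₁ b′ f₂ c′ → c₀ :* f₀ :+ b :* f₁ :+ (b′ :* f₂ :+ c′ :* f₁)
                                      := c₀ :* f₀ :+ b′ :* f₂ :+ (c′ :+ b) :* f₁)
         refl (c 0) (f 0) (b N) (f (suc N)) (b (suc N)) (f (2 ℕ.+ N)) (c (suc N)) ⟩
  c 0 * f 0 + b (suc N) * f (2 ℕ.+ N) + (c (suc N) + b N) * f (suc N)
    ≡⟨ cong (λ x → c 0 * f 0 + b (suc N) * f (2 ℕ.+ N) + x * f (suc N)) (c[1+n]+bn≡0 N) ⟩
  c 0 * f 0 + b (suc N) * f (2 ℕ.+ N) + 0ℚ * f (suc N)
    ≡⟨ cong (c 0 * f 0 + b (suc N) * f (2 ℕ.+ N) +_) (*-zeroˡ (f (suc N))) ⟩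
  c 0 * f 0 + b (suc N) * f (2 ℕ.+ N) + 0ℚ
    ≡⟨ +-identityʳ _ ⟩
  c 0 * f 0 + b (suc N) * f (2 ℕ.+ N)
    ∎
  where open ℚ-Solver.+-*-Solver

∂X^suc-split : ∀ x n m → x * (X^ suc n) (suc m)
  ≡ x * (X^ suc n) m + (x * ι (suc (2 ℕ.* n)) * (X^ suc n) m + x * ι (2 ℕ.* suc n) * (X^ n) m)
∂X^suc-split x n m = begin
  x * (X^ suc n) (suc m)
    ≡⟨ cong (x *_) (∂X^suc n m) ⟩
  x * (ι (2 ℕ.* suc n) * ((X^ suc n) m + (X^ n) m))
    ≡⟨ cong (λ y → x * (y * ((X^ suc n) m + (X^ n) m))) 2[n+1]≡1+[2n+1] ⟩
  x * ((1ℚ + ι (suc (2 ℕ.* n))) * ((X^ suc n) m + (X^ n) m))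
    ≡⟨ solve 4 (λ x o y z → x :* ((con 1ℚ :+ o) :* (y :+ z))
                         := x :* y :+ (x :* o :* y :+ x :* (con 1ℚ :+ o) :* z))
         refl x (ι (suc (2 ℕ.* n))) ((X^ suc n) m) ((X^ n) m) ⟩
  x * (X^ suc n) m + (x * ι (suc (2 ℕ.* n)) * (X^ suc n) m + x * (1ℚ + ι (suc (2 ℕ.* n))) * (X^ n) m)
    ≡⟨ cong (λ y → x * (X^ suc n) m + (x * ι (suc (2 ℕ.* n)) * (X^ suc n) m + x * y * (X^ n) m))
            2[n+1]≡1+[2n+1] ⟨
  x * (X^ suc n) m + (x * ι (suc (2 ℕ.* n)) * (X^ suc n) m + x * ι (2 ℕ.* suc n) * (X^ n) m)
    ∎
  where
  open ℚ-Solver.+-*-Solver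
  2[n+1]≡1+[2n+1] : ι (2 ℕ.* suc n) ≡ 1ℚ + ι (suc (2 ℕ.* n))
  2[n+1]≡1+[2n+1] = trans (cong ι (ℕₚ.*-suc 2 n)) (ι-homo-+ 1 (suc (2 ℕ.* n)))

-- F = Σ a n X^(n+1) satisfies ∂F = F + 2 and F(0) = 0: after ∂X^suc-split, everything but F
-- and the term 2 X^0 of ∂F telescopes away by a-rec.
Σa·X^suc≡2[eᵗ-1] : ∀ {N} m → m ≤ N → sumTo N (λ n → a n * (X^ suc n) m) ≡ ι 2 * eᵗ-1 m
Σa·X^suc≡2[eᵗ-1] {N} zero    _ =
  sumTo-zero N (λ n _ → trans (cong (a n *_) (X^-vanishes (suc n) (s≤s z≤n))) (*-zeroʳ (a n)))
Σa·X^suc≡2[eᵗ-1] {N} (suc m) 1+m≤N = begin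
  sumTo N (λ n → a n * (X^ suc n) (suc m))
    ≡⟨ sumTo-cong N (λ n _ → ∂X^suc-split (a n) n m) ⟩
  sumTo N (λ n → a n * (X^ suc n) m + (b n * (X^ suc n) m + c n * (X^ n) m))
    ≡⟨ sumTo-+ N _ _ ⟩
  sumTo N (λ n → a n * (X^ suc n) m) + sumTo N (λ n → b n * (X^ suc n) m + c n * (X^ n) m)
    ≡⟨ cong₂ _+_ (Σa·X^suc≡2[eᵗ-1] m m≤N) (sumTo-telescope b c (λ n → (X^ n) m) a-rec N) ⟩
  ι 2 * eᵗ-1 m + (c 0 * (X^ 0) m + b N * (X^ suc N) m)
    ≡⟨ cong₂ (λ x y → ι 2 * eᵗ-1 m + (c 0 * x + b N * y)) (X^0≗δ m) (X^-vanishes (suc N) (s≤s m≤N)) ⟩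
  ι 2 * eᵗ-1 m + (c 0 * δ m + b N * 0ℚ)
    ≡⟨ cong (λ x → ι 2 * eᵗ-1 m + (c 0 * δ m + x)) (*-zeroʳ (b N)) ⟩
  ι 2 * eᵗ-1 m + (c 0 * δ m + 0ℚ)
    ≡⟨ eᵗ-1+δ≡1 m ⟩
  ι 2 * 1ℚ
    ∎
  where
  m≤N : m ≤ N
  m≤N = ℕₚ.≤-trans (ℕₚ.n≤1+n m) 1+m≤N
  b c : ℕ → ℚ
  b n = a n * ι (suc (2 ℕ.* n))
  c n = a n * ι (2 ℕ.* suc n)
  eᵗ-1+δ≡1 : ∀ m → ι 2 * eᵗ-1 m + (c 0 * δ m + 0ℚ) ≡ ι 2 * 1ℚ
  eᵗ-1+δ≡1 zero    = refl
  eᵗ-1+δ≡1 (suc _) = refl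

X⊛rhs : X ⊛ rhs ≗ ι 2 · eᵗ-1
X⊛rhs m = begin
  (X ⊛ rhs) m
    ≡⟨ ⊛-cong-≤ m (λ _ _ → refl) (λ _ k≤m → rhs≡Σa·X^ k≤m) ⟩
  (X ⊛ (λ k → sumTo m (λ n → a n * (X^ n) k))) m
    ≡⟨ ⊛-sumTo m m X a X^_ ⟩
  sumTo m (λ n → a n * (X ⊛ X^ n) m)
    ≡⟨ sumTo-cong m (λ n _ → cong (a n *_) (X⊛X^ n m)) ⟩
  sumTo m (λ n → a n * (X^ suc n) m)
    ≡⟨ Σa·X^suc≡2[eᵗ-1] m ℕₚ.≤-refl ⟩
  ι 2 * eᵗ-1 m
    ∎

theorem6 : (E : ℕ → ℚ) → IsEulerSeq E → ∀ (m : ℕ) → E m ≡ rhs m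
theorem6 E isEuler = ⊛-cancelˡ {X} refl (λ ()) (λ m → trans (X⊛euler isEuler m) (sym (X⊛rhs m)))
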